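{- Let $n_1,n_2,n_3,\ell\in\mathbb Z$ satisfy $n_1^2+n_2^2+n_3^2=\ell^2$, and let $u'=(a,b,c)\in\mathbb Z^3$ satisfy $n_1a+n_2b+n_3c=0$. Then there exists $v=(a',b',c')\in\mathbb Z^3$ such that $n_1a'+n_2b'+n_3c'=0$, $v\cdot(\ell u')=0$ and $|v|^2=|\ell u'|^2$; that is, $\ell u'$ and $v$ define a lattice square lying in the plane with normal vector $n=(n_1,n_2,n_3)$. -}

module Defs where

open import Data.Integer using (ℤ; _+_; _*_)
open import Data.Product using (_×_; _,_)

ℤ³ : Set
ℤ³ = ℤ × ℤ × ℤ

_·_ : ℤ³ → ℤ³ → ℤ
(x₁ , y₁ , z₁) · (x₂ , y₂ , z₂) = x₁ * x₂ + y₁ * y₂ + z₁ * z₂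

∣_∣² : ℤ³ → ℤ
∣ u ∣² = u · u

_⋆_ : ℤ → ℤ³ → ℤ³
k ⋆ (x , y , z) = (k * x , k * y , k * z)

{-# OPTIONS --safe #-}
module Submission where

-- Take v = n ⨯ u′. It is orthogonal to n and to u′, and Lagrange's identity
-- |n ⨯ u′|² + (n · u′)² = |n|² |u′|² with n · u′ = 0 and |n|² = ℓ² gives |v|² = ℓ² |u′|² = |ℓ u′|².

open import Defs
open import Data.Integer using (ℤ; _+_; _*_; 0ℤ; _-_)
open import Data.Integer.Properties using (*-zeroˡ; *-zeroʳ; +-identityʳ)
open import Data.Integer.Tactic.RingSolver using (solve-∀)
open import Data.Product using (Σ; _×_; _,_)
open import Relation.Binary.PropositionalEquality using (_≡_; cong; trans; sym; module ≡-Reasoning)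

infixl 7 _⨯_

_⨯_ : ℤ³ → ℤ³ → ℤ³
(x₁ , y₁ , z₁) ⨯ (x₂ , y₂ , z₂) = (y₁ * z₂ - z₁ * y₂ , z₁ * x₂ - x₁ * z₂ , x₁ * y₂ - y₁ * x₂)

·-⨯ˡ : ∀ u v → u · (u ⨯ v) ≡ 0ℤ
·-⨯ˡ (x₁ , y₁ , z₁) (x₂ , y₂ , z₂) = identity x₁ y₁ z₁ x₂ y₂ z₂
  where
  identity : ∀ x₁ y₁ z₁ x₂ y₂ z₂ →
    x₁ * (y₁ * z₂ - z₁ * y₂) + y₁ * (z₁ * x₂ - x₁ * z₂) + z₁ * (x₁ * y₂ - y₁ * x₂) ≡ 0ℤ
  identity = solve-∀

⨯-·ʳ : ∀ u v → (u ⨯ v) · v ≡ 0ℤ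
⨯-·ʳ (x₁ , y₁ , z₁) (x₂ , y₂ , z₂) = identity x₁ y₁ z₁ x₂ y₂ z₂
  where
  identity : ∀ x₁ y₁ z₁ x₂ y₂ z₂ →
    (y₁ * z₂ - z₁ * y₂) * x₂ + (z₁ * x₂ - x₁ * z₂) * y₂ + (x₁ * y₂ - y₁ * x₂) * z₂ ≡ 0ℤ
  identity = solve-∀

·-⋆ʳ : ∀ u k v → u · (k ⋆ v) ≡ k * (u · v)
·-⋆ʳ (x₁ , y₁ , z₁) k (x₂ , y₂ , z₂) = identity x₁ y₁ z₁ k x₂ y₂ z₂
  where
  identity : ∀ x₁ y₁ z₁ k x₂ y₂ z₂ →
    x₁ * (k * x₂) + y₁ * (k * y₂) + z₁ * (k * z₂) ≡ k * (x₁ * x₂ + y₁ * y₂ + z₁ * z₂)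
  identity = solve-∀

∣⋆∣² : ∀ k v → ∣ k ⋆ v ∣² ≡ (k * k) * ∣ v ∣²
∣⋆∣² k (x , y , z) = identity k x y z
  where
  identity : ∀ k x y z →
    (k * x) * (k * x) + (k * y) * (k * y) + (k * z) * (k * z) ≡ (k * k) * (x * x + y * y + z * z)
  identity = solve-∀

lagrange-identity : ∀ u v → ∣ u ⨯ v ∣² + (u · v) * (u · v) ≡ ∣ u ∣² * ∣ v ∣²
lagrange-identity (x₁ , y₁ , z₁) (x₂ , y₂ , z₂) = identity x₁ y₁ z₁ x₂ y₂ z₂
  where
  identity : ∀ x₁ y₁ z₁ x₂ y₂ z₂ →
    (y₁ * z₂ - z₁ * y₂) * (y₁ * z₂ - z₁ * y₂) + (z₁ * x₂ - x₁ * z₂) * (z₁ * x₂ - x₁ * z₂)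
      + (x₁ * y₂ - y₁ * x₂) * (x₁ * y₂ - y₁ * x₂)
      + (x₁ * x₂ + y₁ * y₂ + z₁ * z₂) * (x₁ * x₂ + y₁ * y₂ + z₁ * z₂)
    ≡ (x₁ * x₁ + y₁ * y₁ + z₁ * z₁) * (x₂ * x₂ + y₂ * y₂ + z₂ * z₂)
  identity = solve-∀

∣⨯∣²-orthogonal : ∀ u v → u · v ≡ 0ℤ → ∣ u ⨯ v ∣² ≡ ∣ u ∣² * ∣ v ∣²
∣⨯∣²-orthogonal u v u·v≡0 = begin
  ∣ u ⨯ v ∣²                             ≡⟨ sym (+-identityʳ _) ⟩
  ∣ u ⨯ v ∣² + 0ℤ                        ≡⟨ cong (∣ u ⨯ v ∣² +_) (sym (*-zeroˡ 0ℤ)) ⟩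
  ∣ u ⨯ v ∣² + 0ℤ * 0ℤ                   ≡⟨ cong (λ t → ∣ u ⨯ v ∣² + t * t) (sym u·v≡0) ⟩
  ∣ u ⨯ v ∣² + (u · v) * (u · v)         ≡⟨ lagrange-identity u v ⟩
  ∣ u ∣² * ∣ v ∣²                        ∎
  where open ≡-Reasoning

theorem2p3 : (n₁ n₂ n₃ ℓ : ℤ) → n₁ * n₁ + n₂ * n₂ + n₃ * n₃ ≡ ℓ * ℓ →
    (a b c : ℤ) → n₁ * a + n₂ * b + n₃ * c ≡ 0ℤ →
    Σ ℤ³ λ v → ((n₁ , n₂ , n₃) · v ≡ 0ℤ)
    × (v · (ℓ ⋆ (a , b , c)) ≡ 0ℤ)
    × (∣ v ∣² ≡ ∣ ℓ ⋆ (a , b , c) ∣²)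
theorem2p3 n₁ n₂ n₃ ℓ ∣n∣²≡ℓ² a b c n·u≡0 = n ⨯ u , ·-⨯ˡ n u , n⨯u⊥ℓu , ∣n⨯u∣²≡∣ℓu∣²
  where
  n u : ℤ³
  n = n₁ , n₂ , n₃
  u = a , b , c
  n⨯u⊥ℓu : (n ⨯ u) · (ℓ ⋆ u) ≡ 0ℤ
  n⨯u⊥ℓu = trans (·-⋆ʳ (n ⨯ u) ℓ u) (trans (cong (ℓ *_) (⨯-·ʳ n u)) (*-zeroʳ ℓ))
  ∣n⨯u∣²≡∣ℓu∣² : ∣ n ⨯ u ∣² ≡ ∣ ℓ ⋆ u ∣²
  ∣n⨯u∣²≡∣ℓu∣² = begin
    ∣ n ⨯ u ∣²        ≡⟨ ∣⨯∣²-orthogonal n u n·u≡0 ⟩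
    ∣ n ∣² * ∣ u ∣²   ≡⟨ cong (_* ∣ u ∣²) ∣n∣²≡ℓ² ⟩
    (ℓ * ℓ) * ∣ u ∣²  ≡⟨ sym (∣⋆∣² ℓ u) ⟩
    ∣ ℓ ⋆ u ∣²        ∎
    where open ≡-Reasoning
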